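{- Let $n$ be a positive integer and $\Delta_n=\{\gamma\in B_n:\gamma_n>0\}$. Then \[\sum_{\beta \in B_n} (-1)^{\ell_B(\beta)}q^{\operatorname{fmaj}(\beta)}= \sum_{\gamma \in \Delta_n}(-1)^{\ell_B(\gamma)}q^{\operatorname{fmaj}(\gamma)}\,(1+(-q)^n).\]
   Context: $B_n$ is the group of bijections $\beta$ of $[-n,n]\setminus\{0\}$ with $\beta(-i)=-\beta(i)$, written in window notation $\beta=[\beta_1,\dots,\beta_n]$ with $\beta_i=\beta(i)$. For $\beta\in B_n$: $\operatorname{inv}(\beta)=|\{(i,j): 1\le i<j\le n,\ \beta_i>\beta_j\}|$ (usual order on integers); $\operatorname{N}_1(\beta)=|\{i:\beta_i<0\}|$; $\operatorname{N}_2(\beta)=|\{\{i,j\}: i\neq j,\ \beta_i+\beta_j<0\}|$; the Coxeter length is $\ell_B(\beta)=\operatorname{inv}(\beta)+\operatorname{N}_1(\beta)+\operatorname{N}_2(\beta)$. The descent set $\operatorname{Des}(\beta)$ is the set of $i\in[n-1]$ with $\beta_i\succ\beta_{i+1}$, where $\prec$ is the total order $-1\prec-2\prec\cdots\prec-n\prec 1\prec 2\prec\cdots\prec n$; $\operatorname{maj}(\beta)=\sum_{i\in\operatorname{Des}(\beta)}i$ and $\operatorname{fmaj}(\beta)=2\operatorname{maj}(\beta)+\operatorname{N}_1(\beta)$. (For $\gamma\in\Delta_n$ the paper calls $\operatorname{fmaj}(\gamma)$ the $D$-major index $\operatorname{Dmaj}(\gamma)$.) -}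

module Defs where

open import Level using (Level)
open import Data.Bool using (Bool; true; false; if_then_else_)
open import Data.Nat using (ℕ; zero; suc; _<?_; _<_)
import Data.Nat as ℕ
open import Data.Nat.ListAction using (sum)
open import Data.Fin using (Fin; toℕ; fromℕ; inject₁; _≟_)
import Data.Fin as F
open import Data.Integer as ℤ using (ℤ; +_; -[1+_])
open import Data.Product using (_×_; _,_; proj₁; proj₂)
open import Data.List using (List; []; _∷_; map; concatMap; filter; length; allFin)
open import Data.List.Relation.Unary.All using (All)
open import Relation.Nullary using (Dec; yes; no; ¬_)
open import Relation.Nullary.Decidable using (¬?)
open import Relation.Binary.PropositionalEquality using (_≡_)
open import Algebra.Bundles using (CommutativeRing)

-- A window is a function  w : Fin n → Fin n × Bool ; w i = (a , s) encodes
-- the value β_{i+1} = -(a+1) if s = true and +(a+1) if s = false.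
-- Such a window is an element of B_n iff the absolute-value part is
-- injective (equivalently a permutation of [n]).

Window : ℕ → Set
Window n = Fin n → Fin n × Bool

val : ∀ {n} → Fin n × Bool → ℤ
val (a , true)  = -[1+ toℕ a ]
val (a , false) = + suc (toℕ a)

allFuns : ∀ {A : Set} (xs : List A) (n : ℕ) → List (Fin n → A)
allFuns xs zero    = (λ ()) ∷ []
allFuns xs (suc n) =
  concatMap (λ a → map (λ f → λ { F.zero → a ; (F.suc i) → f i }) (allFuns xs n)) xs

allEntries : (n : ℕ) → List (Fin n × Bool)
allEntries n = concatMap (λ a → (a , false) ∷ (a , true) ∷ []) (allFin n)

AbsInjective : ∀ {n} → Window n → Set
AbsInjective {n} w = All (λ i → All (λ j → proj₁ (w i) ≡ proj₁ (w j) → i ≡ j) (allFin n)) (allFin n)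

absInjective? : ∀ {n} (w : Window n) → Dec (AbsInjective w)
absInjective? {n} w =
  Data.List.Relation.Unary.All.all? (λ i → Data.List.Relation.Unary.All.all?
     (λ j → dec i j) (allFin n)) (allFin n)
  where
  open import Relation.Nullary.Decidable using (_→-dec_)
  dec : ∀ i j → Dec (proj₁ (w i) ≡ proj₁ (w j) → i ≡ j)
  dec i j = (proj₁ (w i) ≟ proj₁ (w j)) →-dec (i ≟ j)

Bn : (n : ℕ) → List (Window n)
Bn n = filter absInjective? (allFuns (allEntries n) n)

-- Δ_n = { γ ∈ B_n : γ_n > 0 }   (for n = suc m; last position is fromℕ m)
Δn : (m : ℕ) → List (Window (suc m))
Δn m = filter (λ w → ¬? (Data.Bool._≟_ (proj₂ (w (fromℕ m))) true)) (Bn (suc m))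

count : ∀ {A : Set} {P : A → Set} → (∀ x → Dec (P x)) → List A → ℕ
count p xs = length (filter p xs)

pairs : (n : ℕ) → List (Fin n × Fin n)
pairs n = concatMap (λ i → map (λ j → (i , j)) (allFin n)) (allFin n)

inv : ∀ {n} → Window n → ℕ
inv {n} w = count (λ { (i , j) → (toℕ i <? toℕ j) Relation.Nullary.Decidable.×-dec
                                   (val (w j) ℤ.<? val (w i)) }) (pairs n)

N₁ : ∀ {n} → Window n → ℕ
N₁ {n} w = count (λ i → val (w i) ℤ.<? + 0) (allFin n)

N₂ : ∀ {n} → Window n → ℕ
N₂ {n} w = count (λ { (i , j) → (toℕ i <? toℕ j) Relation.Nullary.Decidable.×-dec
                                   ((val (w i) ℤ.+ val (w j)) ℤ.<? + 0) }) (pairs n)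

ℓB : ∀ {n} → Window n → ℕ
ℓB w = inv w ℕ.+ N₁ w ℕ.+ N₂ w

-- rank in the total order  -1 ≺ -2 ≺ ... ≺ -n ≺ 1 ≺ 2 ≺ ... ≺ n
rank : ∀ {n} → Fin n × Bool → ℕ
rank     (a , true)  = toℕ a
rank {n} (a , false) = n ℕ.+ toℕ a

-- maj(β) = sum of i ∈ [n-1] with β_i ≻ β_{i+1}
-- (position i (1-based) corresponds to index k = i-1 : Fin (suc m))
maj : ∀ {n} → Window n → ℕ
maj {zero}  w = 0
maj {suc m} w = sum (map (λ k → if Relation.Nullary.Decidable.does
                                     (rank (w (F.suc k)) <? rank (w (inject₁ k)))
                                  then suc (toℕ k) else 0) (allFin m))

fmaj : ∀ {n} → Window n → ℕ
fmaj w = 2 ℕ.* maj w ℕ.+ N₁ w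

module RingOps {c ℓ : Level} (R : CommutativeRing c ℓ) where
  open CommutativeRing R

  pow : Carrier → ℕ → Carrier
  pow x zero    = 1#
  pow x (suc k) = x * pow x k

  ∑ : ∀ {A : Set} → List A → (A → Carrier) → Carrier
  ∑ []       f = 0#
  ∑ (x ∷ xs) f = f x + ∑ xs f

-- Negating all entries, β ↦ −β, is an involution of B_n exchanging Δ_n with B_n ∖ Δ_n.
-- For each pair of positions i < j exactly one of β, −β has an inversion there and exactly
-- one has a negative sum there, and each entry is negative in exactly one of them; hence
-- ℓ_B(β) + ℓ_B(−β) = 2·C(n,2) + n. In the order ≺ negation preserves the relative order
-- of entries of equal sign and puts the other sign class first, so with s_i = [β_i < 0]
-- the descent indicators satisfy d_i(−β) + s_{i+1} = d_i(β) + s_i. Weighting by i and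
-- summing by parts gives maj(−γ) = maj(γ) + N₁(γ) when γ_n > 0, hence
-- fmaj(−γ) = fmaj(γ) + n. So the terms of B_n ∖ Δ_n are those of Δ_n multiplied by (−q)^n.

module Submission where

open import Defs
open import Level using (Level)
open import Algebra.Bundles using (CommutativeRing)
open import Data.Bool as Bool using (Bool; true; false; not; if_then_else_)
open import Data.Nat as ℕ using (ℕ; zero; suc)
open import Data.Fin as Fin using (Fin; toℕ; fromℕ; inject₁)
open import Data.Product using (_×_; _,_; proj₁; proj₂)
open import Data.List using (List; []; _∷_; map; filter; allFin)
open import Data.List.Membership.Propositional using (_∈_)
open import Function using (_∘_; id)
open import Relation.Binary.PropositionalEquality as ≡ using (_≡_; _≗_)
open import Relation.Nullary using (yes; no; does)
open import Relation.Nullary.Decidable using (¬?)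
open import Relation.Unary using (Decidable)

module SignedPermutations where

  open import Data.Bool.Properties using (¬-not)
  open import Data.Empty using (⊥-elim)
  open import Data.Fin.Properties using (toℕ-injective; toℕ<n; toℕ-inject₁; toℕ-fromℕ)
  import Data.Integer as ℤ
  import Data.Integer.Properties as ℤ
  open import Data.List using (length; tabulate)
  open import Data.List.Properties using (map-cong; length-tabulate)
  open import Data.List.Membership.Propositional.Properties using (∈-allFin; ∈-filter⁻)
  import Data.List.Relation.Unary.All as All
  open import Data.Nat using (_+_; _*_; _<?_)
  import Data.Nat.Properties as ℕ
  open import Data.Nat.ListAction using (sum)
  open import Data.Nat.Solver using (module +-*-Solver)
  open +-*-Solver using (solve; _:+_; _:*_; _:=_; con)
  open import Data.Unit using (tt)
  open import Function.Bundles using (mk⇔)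
  open import Relation.Binary.Definitions using (tri<; tri≈; tri>)
  open import Relation.Binary.PropositionalEquality
  open import Relation.Nullary using (Dec; ¬_)
  open import Relation.Nullary.Decidable using (_×-dec_; does-⇔)
  open import Algebra.Properties.AbelianGroup ℤ.+-0-abelianGroup using (inverseʳ-unique)
  open import Algebra.Properties.CommutativeMonoid.Sum ℕ.+-0-commutativeMonoid
    using (sum-syntax; ∑-distrib-+; sum-init-last; sum-cong-≗)
  open import Algebra.Properties.CommutativeSemigroup ℕ.+-commutativeSemigroup using (interchange)

  𝟙 : ∀ {A : Set} → Dec A → ℕ
  𝟙 a? = if does a? then 1 else 0

  𝟙-yes : ∀ {A : Set} (a? : Dec A) → A → 𝟙 a? ≡ 1
  𝟙-yes (yes _) _ = refl
  𝟙-yes (no ¬a) a = ⊥-elim (¬a a)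

  𝟙-no : ∀ {A : Set} (a? : Dec A) → ¬ A → 𝟙 a? ≡ 0
  𝟙-no (yes a) ¬a = ⊥-elim (¬a a)
  𝟙-no (no _)  _  = refl

  𝟙-does : ∀ {P Q : Set} (p : Dec P) (q : Dec Q) → does p ≡ does q → 𝟙 p ≡ 𝟙 q
  𝟙-does p q = cong (if_then 1 else 0)

  module _ {A : Set} where

    count-∷ : {P : A → Set} (p : Decidable P) (x : A) (xs : List A) →
              count p (x ∷ xs) ≡ 𝟙 (p x) + count p xs
    count-∷ p x xs with p x
    ... | yes _ = refl
    ... | no _  = refl

    count-cong : {P Q : A → Set} (p : Decidable P) (q : Decidable Q) →
                 (∀ x → does (p x) ≡ does (q x)) → ∀ xs → count p xs ≡ count q xs
    count-cong p q p≡q []       = refl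
    count-cong p q p≡q (x ∷ xs) = begin
      count p (x ∷ xs)      ≡⟨ count-∷ p x xs ⟩
      𝟙 (p x) + count p xs  ≡⟨ cong₂ _+_ (𝟙-does (p x) (q x) (p≡q x)) (count-cong p q p≡q xs) ⟩
      𝟙 (q x) + count q xs  ≡⟨ count-∷ q x xs ⟨
      count q (x ∷ xs)      ∎
      where open ≡-Reasoning

    count-+ : {P Q S : A → Set} (p : Decidable P) (q : Decidable Q) (s : Decidable S) →
              (∀ x → 𝟙 (p x) + 𝟙 (q x) ≡ 𝟙 (s x)) → ∀ xs → count p xs + count q xs ≡ count s xs
    count-+ p q s split []       = refl
    count-+ p q s split (x ∷ xs) = begin
      count p (x ∷ xs) + count q (x ∷ xs)             ≡⟨ cong₂ _+_ (count-∷ p x xs) (count-∷ q x xs) ⟩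
      (𝟙 (p x) + count p xs) + (𝟙 (q x) + count q xs) ≡⟨ interchange (𝟙 (p x)) _ _ _ ⟩
      (𝟙 (p x) + 𝟙 (q x)) + (count p xs + count q xs) ≡⟨ cong₂ _+_ (split x) (count-+ p q s split xs) ⟩
      𝟙 (s x) + count s xs                            ≡⟨ count-∷ s x xs ⟨
      count s (x ∷ xs)                                ∎
      where open ≡-Reasoning

    count-yes : ∀ xs → count (λ (_ : A) → yes tt) xs ≡ length xs
    count-yes []       = refl
    count-yes (x ∷ xs) = cong suc (count-yes xs)

    count-tabulate : ∀ {n} {P : A → Set} (p : Decidable P) (g : Fin n → A) →
                     count p (tabulate g) ≡ ∑[ i < n ] 𝟙 (p (g i))
    count-tabulate {zero}  p g = refl
    count-tabulate {suc n} p g =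
      trans (count-∷ p (g Fin.zero) _) (cong (𝟙 (p (g Fin.zero)) +_) (count-tabulate p (g ∘ Fin.suc)))

  sum-map-tabulate : ∀ {A : Set} {n} (f : A → ℕ) (g : Fin n → A) →
                     sum (map f (tabulate g)) ≡ ∑[ i < n ] f (g i)
  sum-map-tabulate {n = zero}  f g = refl
  sum-map-tabulate {n = suc n} f g = cong (f (g Fin.zero) +_) (sum-map-tabulate f (g ∘ Fin.suc))

  -- Written with projections so that proj₁ ∘ negate w reduces to proj₁ ∘ w; then
  -- AbsInjective (negate w) and absInjective? (negate w) are those of w by definition.
  negateEntry : ∀ {n} → Fin n × Bool → Fin n × Bool
  negateEntry e = proj₁ e , not (proj₂ e)

  negate : ∀ {n} → Window n → Window n
  negate w = negateEntry ∘ w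

  val-negateEntry : ∀ {n} (e : Fin n × Bool) → val (negateEntry e) ≡ ℤ.- val e
  val-negateEntry (a , true)  = refl
  val-negateEntry (a , false) = refl

  ∣val∣ : ∀ {n} (e : Fin n × Bool) → ℤ.∣ val e ∣ ≡ suc (toℕ (proj₁ e))
  ∣val∣ (a , true)  = refl
  ∣val∣ (a , false) = refl

  val-≡⇒proj₁-≡ : ∀ {n} (e e' : Fin n × Bool) → val e ≡ val e' → proj₁ e ≡ proj₁ e'
  val-≡⇒proj₁-≡ e e' eq = toℕ-injective (ℕ.suc-injective (begin
    suc (toℕ (proj₁ e))  ≡⟨ ∣val∣ e ⟨
    ℤ.∣ val e ∣          ≡⟨ cong ℤ.∣_∣ eq ⟩
    ℤ.∣ val e' ∣         ≡⟨ ∣val∣ e' ⟩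
    suc (toℕ (proj₁ e')) ∎))
    where open ≡-Reasoning

  <-neg-complement : ∀ {x y} → x ≢ y → 𝟙 (y ℤ.<? x) + 𝟙 (ℤ.- y ℤ.<? ℤ.- x) ≡ 1
  <-neg-complement {x} {y} x≢y with ℤ.<-cmp x y
  ... | tri< x<y _ _ = cong₂ _+_ (𝟙-no (y ℤ.<? x) (ℤ.<-asym x<y)) (𝟙-yes (ℤ.- y ℤ.<? ℤ.- x) (ℤ.neg-mono-< x<y))
  ... | tri≈ _ x≡y _ = ⊥-elim (x≢y x≡y)
  ... | tri> _ _ y<x = cong₂ _+_ (𝟙-yes (y ℤ.<? x) y<x) (𝟙-no (ℤ.- y ℤ.<? ℤ.- x) (ℤ.<-asym y<x ∘ ℤ.neg-cancel-<))

  negative-complement : ∀ {n} (e : Fin n × Bool) →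
                        𝟙 (val e ℤ.<? ℤ.0ℤ) + 𝟙 (val (negateEntry e) ℤ.<? ℤ.0ℤ) ≡ 1
  negative-complement (a , true)  = refl
  negative-complement (a , false) = refl

  inversion-complement : ∀ {n} (e e' : Fin n × Bool) → proj₁ e ≢ proj₁ e' →
    𝟙 (val e' ℤ.<? val e) + 𝟙 (val (negateEntry e') ℤ.<? val (negateEntry e)) ≡ 1
  inversion-complement e e' e≢e' rewrite val-negateEntry e | val-negateEntry e' =
    <-neg-complement (e≢e' ∘ val-≡⇒proj₁-≡ e e')

  negativeSum-complement : ∀ {n} (e e' : Fin n × Bool) → proj₁ e ≢ proj₁ e' →
    𝟙 (val e ℤ.+ val e' ℤ.<? ℤ.0ℤ) + 𝟙 (val (negateEntry e) ℤ.+ val (negateEntry e') ℤ.<? ℤ.0ℤ) ≡ 1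
  negativeSum-complement e e' e≢e'
    rewrite val-negateEntry e | val-negateEntry e' | sym (ℤ.neg-distrib-+ (val e) (val e')) =
    <-neg-complement (λ 0≡sum → e≢e' (sym (val-≡⇒proj₁-≡ e' (negateEntry e) (begin
      val e'                 ≡⟨ inverseʳ-unique (val e) (val e') (sym 0≡sum) ⟩
      ℤ.- val e              ≡⟨ val-negateEntry e ⟨
      val (negateEntry e)    ∎))))
    where open ≡-Reasoning

  ×-dec-complement : ∀ {A B C : Set} (a? : Dec A) (b? : Dec B) (c? : Dec C) →
    (A → 𝟙 b? + 𝟙 c? ≡ 1) → 𝟙 (a? ×-dec b?) + 𝟙 (a? ×-dec c?) ≡ 𝟙 a?
  ×-dec-complement (yes a) b? c? b+c≡1 = b+c≡1 a
  ×-dec-complement (no _)  b? c? _     = refl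

  orderedPairs : ℕ → ℕ
  orderedPairs n = count (λ (x : Fin n × Fin n) → toℕ (proj₁ x) <? toℕ (proj₂ x)) (pairs n)

  module _ {n} {w : Window n} (inj : AbsInjective w) where

    absDistinct : ∀ {i j} → toℕ i ℕ.< toℕ j → proj₁ (w i) ≢ proj₁ (w j)
    absDistinct {i} {j} i<j eq =
      ℕ.<-irrefl (cong toℕ (All.lookup (All.lookup inj (∈-allFin i)) (∈-allFin j) eq)) i<j

    inv-negate : inv w + inv (negate w) ≡ orderedPairs n
    inv-negate = count-+ _ _ _ (λ (i , j) → split i j) (pairs n)
      where
      split : ∀ i j → 𝟙 ((toℕ i <? toℕ j) ×-dec (val (w j) ℤ.<? val (w i)))
                      + 𝟙 ((toℕ i <? toℕ j) ×-dec (val (negateEntry (w j)) ℤ.<? val (negateEntry (w i))))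
                      ≡ 𝟙 (toℕ i <? toℕ j)
      split i j = ×-dec-complement (toℕ i <? toℕ j)
                    (val (w j) ℤ.<? val (w i)) (val (negateEntry (w j)) ℤ.<? val (negateEntry (w i)))
                    (inversion-complement (w i) (w j) ∘ absDistinct)

    N₂-negate : N₂ w + N₂ (negate w) ≡ orderedPairs n
    N₂-negate = count-+ _ _ _ (λ (i , j) → split i j) (pairs n)
      where
      split : ∀ i j → 𝟙 ((toℕ i <? toℕ j) ×-dec (val (w i) ℤ.+ val (w j) ℤ.<? ℤ.0ℤ))
                      + 𝟙 ((toℕ i <? toℕ j) ×-dec (val (negateEntry (w i)) ℤ.+ val (negateEntry (w j)) ℤ.<? ℤ.0ℤ))
                      ≡ 𝟙 (toℕ i <? toℕ j)
      split i j = ×-dec-complement (toℕ i <? toℕ j)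
                    (val (w i) ℤ.+ val (w j) ℤ.<? ℤ.0ℤ)
                    (val (negateEntry (w i)) ℤ.+ val (negateEntry (w j)) ℤ.<? ℤ.0ℤ)
                    (negativeSum-complement (w i) (w j) ∘ absDistinct)

  N₁-negate : ∀ {n} (w : Window n) → N₁ w + N₁ (negate w) ≡ n
  N₁-negate {n} w = begin
    N₁ w + N₁ (negate w)            ≡⟨ count-+ _ _ (λ _ → yes tt) (negative-complement ∘ w) (allFin n) ⟩
    count (λ _ → yes tt) (allFin n) ≡⟨ count-yes (allFin n) ⟩
    length (allFin n)               ≡⟨ length-tabulate id ⟩
    n                               ∎
    where open ≡-Reasoning

  ℓB-negate : ∀ {n} {w : Window n} → AbsInjective w →
              ℓB w + ℓB (negate w) ≡ (orderedPairs n + orderedPairs n) + n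
  ℓB-negate {n} {w} inj = begin
    ℓB w + ℓB (negate w)
      ≡⟨ regroup (inv w) (N₁ w) (N₂ w) (inv (negate w)) (N₁ (negate w)) (N₂ (negate w)) ⟩
    (inv w + inv (negate w)) + (N₂ w + N₂ (negate w)) + (N₁ w + N₁ (negate w))
      ≡⟨ cong₂ _+_ (cong₂ _+_ (inv-negate {w = w} inj) (N₂-negate {w = w} inj)) (N₁-negate w) ⟩
    (orderedPairs n + orderedPairs n) + n ∎
    where
    open ≡-Reasoning
    regroup : ∀ a b c a' b' c' → (a + b + c) + (a' + b' + c') ≡ (a + a') + (c + c') + (b + b')
    regroup = solve 6 (λ a b c a' b' c' → (a :+ b :+ c) :+ (a' :+ b' :+ c') := (a :+ a') :+ (c :+ c') :+ (b :+ b')) refl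

  descent? : ∀ {m} (w : Window (suc m)) (k : Fin m) → Dec (rank (w (Fin.suc k)) ℕ.< rank (w (inject₁ k)))
  descent? w k = rank (w (Fin.suc k)) <? rank (w (inject₁ k))

  maj≡∑ : ∀ {m} (w : Window (suc m)) → maj w ≡ ∑[ k < m ] (suc (toℕ k) * 𝟙 (descent? w k))
  maj≡∑ {m} w = trans (sum-map-tabulate (λ k → if does (descent? w k) then suc (toℕ k) else 0) id)
                      (sum-cong-≗ (λ k → if-then-0 (does (descent? w k)) (suc (toℕ k))))
    where
    if-then-0 : ∀ b c → (if b then c else 0) ≡ c * (if b then 1 else 0)
    if-then-0 true  c = sym (ℕ.*-identityʳ c)
    if-then-0 false c = sym (ℕ.*-zeroʳ c)

  N₁≡∑ : ∀ {n} (w : Window n) → N₁ w ≡ ∑[ i < n ] 𝟙 (val (w i) ℤ.<? ℤ.0ℤ)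
  N₁≡∑ w = count-tabulate (λ i → val (w i) ℤ.<? ℤ.0ℤ) id

  +-<-does : ∀ n x y → does (n + x <? n + y) ≡ does (x <? y)
  +-<-does n x y = does-⇔ (mk⇔ (ℕ.+-cancelˡ-< n x y) (ℕ.+-monoʳ-< n)) (n + x <? n + y) (x <? y)

  negative≺positive : ∀ {n} (b b' : Fin n) → rank (b , true) ℕ.< rank (b' , false)
  negative≺positive {n} b b' = ℕ.<-≤-trans (toℕ<n b) (ℕ.m≤m+n n (toℕ b'))

  descent-negate : ∀ {n} (e e' : Fin n × Bool) →
    𝟙 (rank (negateEntry e') <? rank (negateEntry e)) + 𝟙 (val e' ℤ.<? ℤ.0ℤ)
    ≡ 𝟙 (rank e' <? rank e) + 𝟙 (val e ℤ.<? ℤ.0ℤ)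
  descent-negate {n} (a , true) (a' , true) =
    cong (_+ 1) (𝟙-does (n + toℕ a' <? n + toℕ a) (toℕ a' <? toℕ a) (+-<-does n (toℕ a') (toℕ a)))
  descent-negate {n} (a , false) (a' , false) =
    cong (_+ 0) (𝟙-does (toℕ a' <? toℕ a) (n + toℕ a' <? n + toℕ a) (sym (+-<-does n (toℕ a') (toℕ a))))
  descent-negate {n} (a , true) (a' , false) =
    trans (cong (_+ 0) (𝟙-yes (toℕ a' <? n + toℕ a) (negative≺positive a' a)))
          (cong (_+ 1) (sym (𝟙-no (n + toℕ a' <? toℕ a) (ℕ.<-asym (negative≺positive a a')))))
  descent-negate {n} (a , false) (a' , true) =
    trans (cong (_+ 1) (𝟙-no (n + toℕ a' <? toℕ a) (ℕ.<-asym (negative≺positive a a'))))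
          (cong (_+ 0) (sym (𝟙-yes (toℕ a' <? n + toℕ a) (negative≺positive a' a))))

  summation-by-parts : ∀ {m} (x : Fin (suc m) → ℕ) → x (fromℕ m) ≡ 0 →
    ∑[ k < m ] (suc (toℕ k) * x (inject₁ k)) ≡ ∑[ k < m ] (suc (toℕ k) * x (Fin.suc k)) + ∑[ i < suc m ] x i
  summation-by-parts {m} x xₘ≡0 = begin
    T                                    ≡⟨ ℕ.+-identityʳ T ⟨
    T + 0                                ≡⟨ cong (T +_) (ℕ.*-zeroʳ (suc m)) ⟨
    T + suc m * 0                        ≡⟨ cong (λ t → T + suc m * t) xₘ≡0 ⟨
    T + suc m * x (fromℕ m)              ≡⟨ split-last ⟨
    ∑[ i < suc m ] (suc (toℕ i) * x i)   ≡⟨ split-first ⟩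
    U + ∑[ i < suc m ] x i               ∎
    where
    open ≡-Reasoning
    T U : ℕ
    T = ∑[ k < m ] (suc (toℕ k) * x (inject₁ k))
    U = ∑[ k < m ] (suc (toℕ k) * x (Fin.suc k))
    split-last : ∑[ i < suc m ] (suc (toℕ i) * x i) ≡ T + suc m * x (fromℕ m)
    split-last = trans (sum-init-last (λ i → suc (toℕ i) * x i))
      (cong₂ _+_ (sum-cong-≗ (λ k → cong (λ t → suc t * x (inject₁ k)) (toℕ-inject₁ k)))
                 (cong (λ t → suc t * x (fromℕ m)) (toℕ-fromℕ m)))
    -- (k + 2) * y unfolds to y + (k + 1) * y by the definition of _*_.
    split-first : ∑[ i < suc m ] (suc (toℕ i) * x i) ≡ U + ∑[ i < suc m ] x i
    split-first = trans (cong (1 * x Fin.zero +_) (∑-distrib-+ (x ∘ Fin.suc) (λ k → suc (toℕ k) * x (Fin.suc k))))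
      (solve 3 (λ a b c → con 1 :* a :+ (b :+ c) := c :+ (a :+ b)) refl (x Fin.zero) (∑[ k < m ] x (Fin.suc k)) U)

  𝟙-positive : ∀ {n} (e : Fin n × Bool) → proj₂ e ≡ false → 𝟙 (val e ℤ.<? ℤ.0ℤ) ≡ 0
  𝟙-positive (a , false) refl = refl

  maj-negate : ∀ {m} (w : Window (suc m)) → proj₂ (w (fromℕ m)) ≡ false → maj (negate w) ≡ maj w + N₁ w
  maj-negate {m} w lastPositive = ℕ.+-cancelʳ-≡ U (maj (negate w)) (maj w + N₁ w) (begin
    maj (negate w) + U
      ≡⟨ cong (_+ U) (maj≡∑ (negate w)) ⟩
    ∑[ k < m ] (place k * 𝟙 (descent? (negate w) k)) + U
      ≡⟨ ∑-distrib-+ (λ k → place k * 𝟙 (descent? (negate w) k)) (λ k → place k * neg (Fin.suc k)) ⟨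
    ∑[ k < m ] (place k * 𝟙 (descent? (negate w) k) + place k * neg (Fin.suc k))
      ≡⟨ sum-cong-≗ descents-negate ⟩
    ∑[ k < m ] (place k * 𝟙 (descent? w k) + place k * neg (inject₁ k))
      ≡⟨ ∑-distrib-+ (λ k → place k * 𝟙 (descent? w k)) (λ k → place k * neg (inject₁ k)) ⟩
    ∑[ k < m ] (place k * 𝟙 (descent? w k)) + ∑[ k < m ] (place k * neg (inject₁ k))
      ≡⟨ cong₂ _+_ (sym (maj≡∑ w)) (summation-by-parts neg (𝟙-positive (w (fromℕ m)) lastPositive)) ⟩
    maj w + (U + ∑[ i < suc m ] neg i)
      ≡⟨ cong (λ t → maj w + (U + t)) (N₁≡∑ w) ⟨
    maj w + (U + N₁ w)
      ≡⟨ cong (maj w +_) (ℕ.+-comm U (N₁ w)) ⟩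
    maj w + (N₁ w + U)
      ≡⟨ ℕ.+-assoc (maj w) (N₁ w) U ⟨
    maj w + N₁ w + U ∎)
    where
    open ≡-Reasoning
    place : Fin m → ℕ
    place k = suc (toℕ k)
    neg : Fin (suc m) → ℕ
    neg i = 𝟙 (val (w i) ℤ.<? ℤ.0ℤ)
    U : ℕ
    U = ∑[ k < m ] (place k * neg (Fin.suc k))
    descents-negate : ∀ k → place k * 𝟙 (descent? (negate w) k) + place k * neg (Fin.suc k)
                            ≡ place k * 𝟙 (descent? w k) + place k * neg (inject₁ k)
    descents-negate k = begin
      place k * 𝟙 (descent? (negate w) k) + place k * neg (Fin.suc k)
        ≡⟨ ℕ.*-distribˡ-+ (place k) (𝟙 (descent? (negate w) k)) (neg (Fin.suc k)) ⟨
      place k * (𝟙 (descent? (negate w) k) + neg (Fin.suc k))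
        ≡⟨ cong (place k *_) (descent-negate (w (inject₁ k)) (w (Fin.suc k))) ⟩
      place k * (𝟙 (descent? w k) + neg (inject₁ k))
        ≡⟨ ℕ.*-distribˡ-+ (place k) (𝟙 (descent? w k)) (neg (inject₁ k)) ⟩
      place k * 𝟙 (descent? w k) + place k * neg (inject₁ k) ∎

  fmaj-negate : ∀ {m} (w : Window (suc m)) → proj₂ (w (fromℕ m)) ≡ false → fmaj (negate w) ≡ fmaj w + suc m
  fmaj-negate {m} w lastPositive = begin
    2 * maj (negate w) + N₁ (negate w)        ≡⟨ cong (λ t → 2 * t + N₁ (negate w)) (maj-negate w lastPositive) ⟩
    2 * (maj w + N₁ w) + N₁ (negate w)        ≡⟨ regroup (maj w) (N₁ w) (N₁ (negate w)) ⟩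
    2 * maj w + N₁ w + (N₁ w + N₁ (negate w)) ≡⟨ cong (2 * maj w + N₁ w +_) (N₁-negate w) ⟩
    fmaj w + suc m                            ∎
    where
    open ≡-Reasoning
    regroup : ∀ a b c → 2 * (a + b) + c ≡ 2 * a + b + (b + c)
    regroup = solve 3 (λ a b c → con 2 :* (a :+ b) :+ c := con 2 :* a :+ b :+ (b :+ c)) refl

  maj-cong : ∀ {n} {w w' : Window n} → w ≗ w' → maj w ≡ maj w'
  maj-cong {zero}  _ = refl
  maj-cong {suc m} w≗w' = cong sum (map-cong (λ k →
    cong₂ (λ a b → if does (rank a <? rank b) then suc (toℕ k) else 0) (w≗w' (Fin.suc k)) (w≗w' (inject₁ k)))
    (allFin m))

  module _ {n} {w w' : Window n} (w≗w' : w ≗ w') where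

    inv-cong : inv w ≡ inv w'
    inv-cong = count-cong _ _ (λ (i , j) →
      cong₂ (λ a b → does ((toℕ i <? toℕ j) ×-dec (val b ℤ.<? val a))) (w≗w' i) (w≗w' j)) (pairs n)

    N₁-cong : N₁ w ≡ N₁ w'
    N₁-cong = count-cong _ _ (λ i → cong (λ a → does (val a ℤ.<? ℤ.0ℤ)) (w≗w' i)) (allFin n)

    N₂-cong : N₂ w ≡ N₂ w'
    N₂-cong = count-cong _ _ (λ (i , j) →
      cong₂ (λ a b → does ((toℕ i <? toℕ j) ×-dec (val a ℤ.+ val b ℤ.<? ℤ.0ℤ))) (w≗w' i) (w≗w' j)) (pairs n)

    ℓB-cong : ℓB w ≡ ℓB w'
    ℓB-cong = cong₂ _+_ (cong₂ _+_ inv-cong N₁-cong) N₂-cong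

    fmaj-cong : fmaj w ≡ fmaj w'
    fmaj-cong = cong₂ _+_ (cong (2 *_) (maj-cong w≗w')) N₁-cong

    absInjective?-cong : does (absInjective? w) ≡ does (absInjective? w')
    absInjective?-cong =
      does-⇔ (mk⇔ (transport w≗w') (transport (sym ∘ w≗w'))) (absInjective? w) (absInjective? w')
      where
      transport : ∀ {v v' : Window n} → v ≗ v' → AbsInjective v → AbsInjective v'
      transport v≗v' = All.map (λ {i} → All.map (λ {j} injective eq →
        injective (trans (cong proj₁ (v≗v' i)) (trans eq (cong proj₁ (sym (v≗v' j)))))))

  Δn-member : ∀ {m} {γ : Window (suc m)} → γ ∈ Δn m → AbsInjective γ × proj₂ (γ (fromℕ m)) ≡ false
  Δn-member {m} γ∈Δ =
    let γ∈B , lastNotNegative =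
          ∈-filter⁻ (λ w → ¬? (proj₂ (w (fromℕ m)) Bool.≟ true)) {xs = Bn (suc m)} γ∈Δ
    in proj₂ (∈-filter⁻ absInjective? {xs = allFuns (allEntries (suc m)) (suc m)} γ∈B) ,
       ¬-not lastNotNegative


module RingSums {c ℓ : Level} (R : CommutativeRing c ℓ) where

  open import Data.List using (concatMap; _++_)
  open import Data.List.Relation.Unary.Any using (here; there)
  import Data.Vec.Functional as Vector
  open import Relation.Binary.Core using (_Preserves_⟶_)
  open SignedPermutations

  open CommutativeRing R
  open RingOps R
  open import Relation.Binary.Reasoning.Setoid setoid
  open import Algebra.Properties.CommutativeSemigroup +-commutativeSemigroup
    using () renaming (x∙yz≈y∙xz to x+[y+z]≈y+[x+z])
  open import Algebra.Properties.CommutativeSemigroup *-commutativeSemigroup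
    using (x∙yz≈yx∙z) renaming (interchange to *-interchange)
  open import Algebra.Properties.Ring ring using (-1*x≈-x; -‿involutive)
  open import Algebra.Properties.Semiring.Exp semiring using (_^_; ^-congˡ; ^-congʳ; ^-homo-*)
  open import Algebra.Properties.CommutativeSemiring.Exp commutativeSemiring using (^-distrib-*)

  module _ {A : Set} where

    ∑-cong-∈ : ∀ (xs : List A) {f g : A → Carrier} → (∀ {x} → x ∈ xs → f x ≈ g x) → ∑ xs f ≈ ∑ xs g
    ∑-cong-∈ []       f≈g = refl
    ∑-cong-∈ (x ∷ xs) f≈g = +-cong (f≈g (here ≡.refl)) (∑-cong-∈ xs (f≈g ∘ there))

    ∑-cong : ∀ (xs : List A) {f g : A → Carrier} → (∀ x → f x ≈ g x) → ∑ xs f ≈ ∑ xs g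
    ∑-cong xs f≈g = ∑-cong-∈ xs (λ {x} _ → f≈g x)

    ∑-++ : ∀ (xs ys : List A) (f : A → Carrier) → ∑ (xs ++ ys) f ≈ ∑ xs f + ∑ ys f
    ∑-++ []       ys f = sym (+-identityˡ _)
    ∑-++ (x ∷ xs) ys f = trans (+-congˡ (∑-++ xs ys f)) (sym (+-assoc _ _ _))

    ∑-*ʳ : ∀ (xs : List A) (f : A → Carrier) a → ∑ xs f * a ≈ ∑ xs (λ x → f x * a)
    ∑-*ʳ []       f a = zeroˡ a
    ∑-*ʳ (x ∷ xs) f a = trans (distribʳ a (f x) (∑ xs f)) (+-congˡ (∑-*ʳ xs f a))

    ∑-filter : ∀ {P : A → Set} (p : Decidable P) (xs : List A) (f : A → Carrier) →
               ∑ (filter p xs) f ≈ ∑ xs (λ x → if does (p x) then f x else 0#)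
    ∑-filter p []       f = refl
    ∑-filter p (x ∷ xs) f with does (p x)
    ... | true  = +-congˡ (∑-filter p xs f)
    ... | false = trans (∑-filter p xs f) (sym (+-identityˡ _))

    ∑-filter-filter : ∀ {P Q : A → Set} (p : Decidable P) (q : Decidable Q) (xs : List A) (f : A → Carrier) →
      ∑ (filter p (filter q xs)) f ≈ ∑ xs (λ x → if does (q x) then (if does (p x) then f x else 0#) else 0#)
    ∑-filter-filter p q xs f = trans (∑-filter p (filter q xs) f) (∑-filter q xs _)

    ∑-filter-partition : ∀ {P : A → Set} (p : Decidable P) (xs : List A) (f : A → Carrier) →
                         ∑ xs f ≈ ∑ (filter (λ x → ¬? (p x)) xs) f + ∑ (filter p xs) f
    ∑-filter-partition p []       f = sym (+-identityˡ 0#)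
    ∑-filter-partition p (x ∷ xs) f with p x
    ... | yes _ = trans (+-congˡ (∑-filter-partition p xs f)) (x+[y+z]≈y+[x+z] _ _ _)
    ... | no _  = trans (+-congˡ (∑-filter-partition p xs f)) (sym (+-assoc _ _ _))

  module _ {A B : Set} where

    ∑-map : ∀ (h : A → B) (xs : List A) (f : B → Carrier) → ∑ (map h xs) f ≈ ∑ xs (f ∘ h)
    ∑-map h []       f = refl
    ∑-map h (x ∷ xs) f = +-congˡ (∑-map h xs f)

    ∑-concatMap : ∀ (k : A → List B) (xs : List A) (f : B → Carrier) →
                  ∑ (concatMap k xs) f ≈ ∑ xs (λ a → ∑ (k a) f)
    ∑-concatMap k []       f = refl
    ∑-concatMap k (x ∷ xs) f = trans (∑-++ (k x) (concatMap k xs) f) (+-congˡ (∑-concatMap k xs f))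

  module _ {A : Set} (xs : List A) where

    -- allFuns builds its functions by pattern-matching lambdas, which agree with a Vector.∷ f
    -- only pointwise; this is why the summands must respect _≗_.
    ∑-allFuns-suc : ∀ k (g : (Fin (suc k) → A) → Carrier) → g Preserves _≗_ ⟶ _≈_ →
      ∑ (allFuns xs (suc k)) g ≈ ∑ xs (λ a → ∑ (allFuns xs k) (λ f → g (a Vector.∷ f)))
    ∑-allFuns-suc k g g-cong = trans (∑-concatMap _ xs g) (∑-cong xs (λ a →
      trans (∑-map _ (allFuns xs k) g) (∑-cong (allFuns xs k) (λ f →
        g-cong λ { Fin.zero → ≡.refl ; (Fin.suc i) → ≡.refl }))))

    ∑-allFuns-∘ : (ν : A → A) → (∀ h → ∑ xs (h ∘ ν) ≈ ∑ xs h) →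
      ∀ k (g : (Fin k → A) → Carrier) → g Preserves _≗_ ⟶ _≈_ →
      ∑ (allFuns xs k) (λ f → g (ν ∘ f)) ≈ ∑ (allFuns xs k) g
    ∑-allFuns-∘ ν ν-invariant zero    g g-cong = +-congʳ (g-cong (λ ()))
    ∑-allFuns-∘ ν ν-invariant (suc k) g g-cong = begin
      ∑ (allFuns xs (suc k)) (λ f → g (ν ∘ f))
        ≈⟨ ∑-allFuns-suc k (λ f → g (ν ∘ f)) (λ f≗f' → g-cong (≡.cong ν ∘ f≗f')) ⟩
      ∑ xs (λ a → ∑ (allFuns xs k) (λ f → g (ν ∘ (a Vector.∷ f))))
        ≈⟨ ∑-cong xs (λ a → ∑-cong (allFuns xs k) (λ f →
             g-cong λ { Fin.zero → ≡.refl ; (Fin.suc i) → ≡.refl })) ⟩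
      ∑ xs (λ a → ∑ (allFuns xs k) (λ f → g (ν a Vector.∷ (ν ∘ f))))
        ≈⟨ ∑-cong xs (λ a → ∑-allFuns-∘ ν ν-invariant k (λ f → g (ν a Vector.∷ f))
             (λ f≗f' → g-cong λ { Fin.zero → ≡.refl ; (Fin.suc i) → f≗f' i })) ⟩
      ∑ xs (λ a → ∑ (allFuns xs k) (λ f → g (ν a Vector.∷ f)))
        ≈⟨ ν-invariant (λ a → ∑ (allFuns xs k) (λ f → g (a Vector.∷ f))) ⟩
      ∑ xs (λ a → ∑ (allFuns xs k) (λ f → g (a Vector.∷ f)))
        ≈⟨ ∑-allFuns-suc k g g-cong ⟨
      ∑ (allFuns xs (suc k)) g ∎

  ∑-allEntries-negateEntry : ∀ n (h : Fin n × Bool → Carrier) →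
                             ∑ (allEntries n) (h ∘ negateEntry) ≈ ∑ (allEntries n) h
  ∑-allEntries-negateEntry n h = begin
    ∑ (allEntries n) (h ∘ negateEntry)
      ≈⟨ ∑-concatMap _ (allFin n) (h ∘ negateEntry) ⟩
    ∑ (allFin n) (λ a → h (a , true) + (h (a , false) + 0#))
      ≈⟨ ∑-cong (allFin n) (λ a → x+[y+z]≈y+[x+z] (h (a , true)) (h (a , false)) 0#) ⟩
    ∑ (allFin n) (λ a → h (a , false) + (h (a , true) + 0#))
      ≈⟨ ∑-concatMap _ (allFin n) h ⟨
    ∑ (allEntries n) h ∎

  pow≈^ : ∀ x k → pow x k ≈ x ^ k
  pow≈^ x zero    = refl
  pow≈^ x (suc k) = *-congˡ (pow≈^ x k)

  sign-square : ∀ a → (- 1#) ^ a * (- 1#) ^ a ≈ 1#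
  sign-square a = begin
    (- 1#) ^ a * (- 1#) ^ a ≈⟨ ^-distrib-* (- 1#) (- 1#) a ⟨
    (- 1# * - 1#) ^ a       ≈⟨ ^-congˡ a (trans (-1*x≈-x (- 1#)) (-‿involutive 1#)) ⟩
    1# ^ a                  ≈⟨ 1^a≈1 a ⟩
    1#                      ∎
    where
    1^a≈1 : ∀ a → 1# ^ a ≈ 1#
    1^a≈1 zero    = refl
    1^a≈1 (suc a) = trans (*-identityˡ _) (1^a≈1 a)

  sign-complement : ∀ l l' P n → l ℕ.+ l' ≡ (P ℕ.+ P) ℕ.+ n → (- 1#) ^ l' ≈ (- 1#) ^ l * (- 1#) ^ n
  sign-complement l l' P n l+l'≡2P+n = begin
    s l'                       ≈⟨ *-identityʳ (s l') ⟨
    s l' * 1#                  ≈⟨ *-congˡ (sign-square l) ⟨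
    s l' * (s l * s l)         ≈⟨ x∙yz≈yx∙z (s l') (s l) (s l) ⟩
    (s l * s l') * s l         ≈⟨ *-congʳ (^-homo-* (- 1#) l l') ⟨
    s (l ℕ.+ l') * s l         ≈⟨ *-congʳ (^-congʳ (- 1#) l+l'≡2P+n) ⟩
    s ((P ℕ.+ P) ℕ.+ n) * s l  ≈⟨ *-congʳ (^-homo-* (- 1#) (P ℕ.+ P) n) ⟩
    (s (P ℕ.+ P) * s n) * s l  ≈⟨ *-congʳ (*-congʳ (trans (^-homo-* (- 1#) P P) (sign-square P))) ⟩
    (1# * s n) * s l           ≈⟨ *-congʳ (*-identityˡ (s n)) ⟩
    s n * s l                  ≈⟨ *-comm (s n) (s l) ⟩
    s l * s n                  ∎
    where
    s : ℕ → Carrier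
    s = (- 1#) ^_

  weight : Carrier → ∀ {n} → Window n → Carrier
  weight q w = pow (- 1#) (ℓB w) * pow q (fmaj w)

  weight-negate : ∀ q {m} (w : Window (suc m)) → AbsInjective w → proj₂ (w (fromℕ m)) ≡ false →
                  weight q (negate w) ≈ weight q w * pow (- q) (suc m)
  weight-negate q {m} w inj lastPositive = begin
    pow (- 1#) (ℓB (negate w)) * pow q (fmaj (negate w))
      ≈⟨ *-cong (pow≈^ (- 1#) (ℓB (negate w))) (pow≈^ q (fmaj (negate w))) ⟩
    (- 1#) ^ ℓB (negate w) * q ^ fmaj (negate w)
      ≈⟨ *-cong (sign-complement (ℓB w) (ℓB (negate w)) (orderedPairs (suc m)) (suc m) (ℓB-negate inj))
                (trans (^-congʳ q (fmaj-negate w lastPositive)) (^-homo-* q (fmaj w) (suc m))) ⟩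
    ((- 1#) ^ ℓB w * (- 1#) ^ suc m) * (q ^ fmaj w * q ^ suc m)
      ≈⟨ *-interchange ((- 1#) ^ ℓB w) ((- 1#) ^ suc m) (q ^ fmaj w) (q ^ suc m) ⟩
    ((- 1#) ^ ℓB w * q ^ fmaj w) * ((- 1#) ^ suc m * q ^ suc m)
      ≈⟨ *-cong (*-cong (pow≈^ (- 1#) (ℓB w)) (pow≈^ q (fmaj w)))
                (trans (^-congˡ (suc m) (sym (-1*x≈-x q))) (^-distrib-* (- 1#) q (suc m))) ⟨
    weight q w * (- q) ^ suc m
      ≈⟨ *-congˡ (pow≈^ (- q) (suc m)) ⟨
    weight q w * pow (- q) (suc m) ∎

  lastNegative? : ∀ m → Decidable (λ (w : Window (suc m)) → proj₂ (w (fromℕ m)) ≡ true)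
  lastNegative? m w = proj₂ (w (fromℕ m)) Bool.≟ true

  ∑-lastNegative≈∑-Δn-negate : ∀ q m →
    ∑ (filter (lastNegative? m) (Bn (suc m))) (weight q) ≈ ∑ (Δn m) (weight q ∘ negate)
  ∑-lastNegative≈∑-Δn-negate q m = begin
    ∑ (filter (lastNegative? m) (Bn N)) (weight q)
      ≈⟨ ∑-filter-filter (lastNegative? m) absInjective? L (weight q) ⟩
    ∑ L H
      ≈⟨ ∑-allFuns-∘ (allEntries N) negateEntry (∑-allEntries-negateEntry N) N H H-cong ⟨
    ∑ L (H ∘ negate)
      ≈⟨ ∑-cong L (λ w → reflexive (≡.cong (λ b → restrict b (weight q (negate w)) w)
                                            (lastNegative-not (proj₂ (w (fromℕ m)))))) ⟩
    ∑ L (λ w → restrict (does (¬? (lastNegative? m w))) (weight q (negate w)) w)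
      ≈⟨ ∑-filter-filter (λ w → ¬? (lastNegative? m w)) absInjective? L (weight q ∘ negate) ⟨
    ∑ (Δn m) (weight q ∘ negate) ∎
    where
    N : ℕ
    N = suc m
    L : List (Window N)
    L = allFuns (allEntries N) N
    restrict : Bool → Carrier → Window N → Carrier
    restrict b x w = if does (absInjective? w) then (if b then x else 0#) else 0#
    H : Window N → Carrier
    H w = restrict (does (lastNegative? m w)) (weight q w) w
    H-cong : H Preserves _≗_ ⟶ _≈_
    H-cong {w} {w'} w≗w' = reflexive (≡.cong₂ (λ i r → if i then r else 0#) (absInjective?-cong w≗w')
      (≡.cong₂ (λ b x → if b then x else 0#) (≡.cong (λ e → does (proj₂ e Bool.≟ true)) (w≗w' (fromℕ m)))
        (≡.cong₂ (λ l f → pow (- 1#) l * pow q f) (ℓB-cong w≗w') (fmaj-cong w≗w'))))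
    lastNegative-not : ∀ b → does (not b Bool.≟ true) ≡ does (¬? (b Bool.≟ true))
    lastNegative-not true  = ≡.refl
    lastNegative-not false = ≡.refl

open SignedPermutations using (negate; Δn-member)

proposition4p2 : {c ℓ : Level} (R : CommutativeRing c ℓ) (q : CommutativeRing.Carrier R) (m : ℕ) →
  let open CommutativeRing R
      open RingOps R
  in ∑ (Bn (suc m)) (λ β → pow (- 1#) (ℓB β) * pow q (fmaj β))
     ≈ ∑ (Δn m) (λ γ → pow (- 1#) (ℓB γ) * pow q (fmaj γ)) * (1# + pow (- q) (suc m))
proposition4p2 R q m = begin
  ∑ (Bn (suc m)) F                                             ≈⟨ ∑-filter-partition (lastNegative? m) (Bn (suc m)) F ⟩
  ∑ (Δn m) F + ∑ (filter (lastNegative? m) (Bn (suc m))) F     ≈⟨ +-congˡ (∑-lastNegative≈∑-Δn-negate q m) ⟩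
  ∑ (Δn m) F + ∑ (Δn m) (F ∘ negate)                           ≈⟨ +-congˡ (∑-cong-∈ (Δn m) weight-negate-Δn) ⟩
  ∑ (Δn m) F + ∑ (Δn m) (λ γ → F γ * c)                       ≈⟨ +-cong (*-identityʳ _) (∑-*ʳ (Δn m) F c) ⟨
  ∑ (Δn m) F * 1# + ∑ (Δn m) F * c                             ≈⟨ distribˡ _ 1# c ⟨
  ∑ (Δn m) F * (1# + c)                                        ∎
  where
  open CommutativeRing R
  open RingOps R
  open RingSums R
  open import Relation.Binary.Reasoning.Setoid setoid
  F : Window (suc m) → Carrier
  F = weight q
  c : Carrier
  c = pow (- q) (suc m)
  weight-negate-Δn : ∀ {γ} → γ ∈ Δn m → F (negate γ) ≈ F γ * c
  weight-negate-Δn γ∈Δ = let inj , lastPositive = Δn-member γ∈Δ in weight-negate q _ inj lastPositive
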